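{- Let $k\ge 1$ and $n\ge 0$ be integers, and write $n=km+j$ with integers $m\ge0$ and $0 \leq j < k$. Then \[ \mathrm{mp}_C(n,k) = \frac{j+1}{km+j+1} \binom{(k+1)m + j}{km+j}, \] and in particular \[ \mathrm{mp}_C(km,k) = \frac{1}{(k+1)m+1} \binom{(k+1)m+1}{m} = \frac{1}{km+1} \binom{(k+1)m}{m}. \]
   Context: A subexcedant function on $[n]$ is a map $f:[n]\to[n]$ with $1\le f(i)\le i$ for all $i$. For a subexcedant function $f$ define the permutation $\varphi(f) = (n\ f(n)) \circ \dots \circ (2\ f(2)) \circ (1\ f(1))$, where $(a\ b)$ is the transposition swapping $a,b$ (the identity if $a=b$) and $\circ$ is composition of functions; $\varphi$ is a bijection from subexcedant functions on $[n]$ to permutations of $[n]$. For $\pi$ a permutation write $f_\pi=\varphi^{ -1}(\pi)$. A word $w_1\cdots w_n$ of positive integers is a Catalan word if $w_1=1$ and $1\le w_i\le w_{i-1}+1$ for $2\le i\le n$. A permutation $\pi$ of $[n]$ is mod-$k$-alternating if $\pi(i)\equiv i\pmod k$ for all $i$. $\mathrm{mp}_C(n,k)$ denotes the number of mod-$k$-alternating permutations $\pi$ of $[n]$ such that $f_\pi(1)f_\pi(2)\cdots f_\pi(n)$ is a Catalan word (the empty permutation counts, so $\mathrm{mp}_C(0,k)=1$). -}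

module Defs where

open import Data.Nat using (ℕ; zero; suc; _+_; _*_; _≡ᵇ_; _≤ᵇ_; NonZero)
open import Data.Nat.DivMod using (_%_)
open import Data.Bool using (Bool; true; false; _∧_; if_then_else_)
open import Data.List using (List; []; _∷_; [_]; _++_; map; concatMap; upTo; length; filterᵇ)
open import Data.Bool.ListAction using (and)

-- A subexcedant function f on [n] is encoded by its word f(1) f(2) ... f(n)
-- (a list of length n of positive naturals with 1 ≤ f(i) ≤ i).

range1 : ℕ → List ℕ
range1 n = map suc (upTo n)

subexcedant : ℕ → List (List ℕ)
subexcedant zero    = [ [] ]
subexcedant (suc n) =
  concatMap (λ w → map (λ v → w ++ [ v ]) (range1 (suc n))) (subexcedant n)

transp : ℕ → ℕ → ℕ → ℕ
transp a b x = if x ≡ᵇ a then b else (if x ≡ᵇ b then a else x)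

-- φ(f) = (n f(n)) ∘ ... ∘ (2 f(2)) ∘ (1 f(1)) as a function on ℕ
-- (the transposition (1 f(1)) is applied first).
φ-from : ℕ → List ℕ → ℕ → ℕ
φ-from i []      x = x
φ-from i (w ∷ ws) x = φ-from (suc i) ws (transp i w x)

φ : List ℕ → ℕ → ℕ
φ = φ-from 1

catalanTail : ℕ → List ℕ → Bool
catalanTail prev []       = true
catalanTail prev (w ∷ ws) = (1 ≤ᵇ w) ∧ (w ≤ᵇ suc prev) ∧ catalanTail w ws

isCatalan : List ℕ → Bool
isCatalan []       = true
isCatalan (w ∷ ws) = (w ≡ᵇ 1) ∧ catalanTail w ws

isModAlt : (k : ℕ) .{{_ : NonZero k}} → (n : ℕ) → (ℕ → ℕ) → Bool
isModAlt k n π = and (map (λ i → (π i % k) ≡ᵇ (i % k)) (range1 n))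

-- mp_C(n,k): number of mod-k-alternating permutations π of [n] with f_π Catalan.
-- Since φ is a bijection from subexcedant functions to permutations, we count
-- subexcedant f with f Catalan and φ(f) mod-k-alternating (π = φ(f), f = f_π).
mpC : (n k : ℕ) .{{_ : NonZero k}} → ℕ
mpC n k = length (filterᵇ (λ f → isCatalan f ∧ isModAlt k n (φ f)) (subexcedant n))

{-# OPTIONS --safe #-}
module Submission where

-- Appending a letter v to a word w of length n turns φ w into (n+1 v) ∘ φ w. As φ w fixes n+1,
-- the new permutation sends n+1 to v, and when v ≡ n+1 (mod k) the transposition preserves
-- residues, so the other values keep theirs. Hence the counted words are the Catalan words with
-- f(i) ≡ i (mod k), i.e. f(i) = i - k eᵢ with e₁ ≤ e₂ ≤ ⋯ and k eᵢ < i. Grouped by eₙ they are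
-- ballot numbers, whose partial sums over e′ ≤ e equal C(n+e, e) - k C(n+e, e-1) while k e ≤ n
-- (Pascal's rule and absorption). For n = k m + j the count is the partial sum up to e = m, which
-- absorption turns into (j+1)/(n+1) · C(n+m, m).

open import Defs
open import Data.Nat
  using (ℕ; zero; suc; _+_; _*_; _∸_; _<_; _≤_; _≡ᵇ_; _≤ᵇ_; _%_; _/_; s≤s; NonZero; >-nonZero⁻¹)
open import Data.Nat.Combinatorics
  using (_C_; nCk+nC[k+1]≡[n+1]C[k+1]; nC1≡n; nCk≡nC[n∸k])
open import Data.Product using (_×_; _,_)
open import Relation.Binary.PropositionalEquality
  using (_≡_; refl; sym; trans; cong; cong₂; subst; subst₂; _≗_; _≢_; module ≡-Reasoning)

open import Algebra.Bundles using (CommutativeMonoid)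
import Algebra.Properties.CommutativeSemigroup as CommutativeSemigroupProperties
open import Data.Bool using (Bool; true; false; _∧_; if_then_else_; T)
open import Data.Bool.Properties
  using (∧-assoc; ∧-identityʳ; ∧-zeroʳ; ∧-commutativeMonoid; if-∧; if-swap-then)
open import Data.Bool.ListAction using (and)
open import Data.List
  using (List; []; _∷_; [_]; _++_; map; concatMap; upTo; length; filterᵇ; foldl)
open import Data.List.Properties
  using (map-++; map-∘; map-cong; map-cong-local; upTo-∷ʳ; length-++; foldl-∷ʳ)
open import Data.List.Relation.Unary.All as All using (All; []; _∷_)
open import Data.List.Relation.Unary.All.Properties using (concat⁺; map⁺; applyUpTo⁺₁)
open import Data.Nat.DivMod using (m≡m%n+[m/n]*n; m*n≤o⇒[o∸m*n]%n≡o%n)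
open import Data.Nat.Divisibility using (divides; _∣?_; _∣0)
open import Data.Nat.ListAction using (sum)
open import Data.Nat.ListAction.Properties using (sum-++)
open import Data.Nat.Properties
open import Data.Nat.Tactic.RingSolver using (solve-∀)
open import Function using (_∘_)
open import Relation.Nullary using (¬_; yes; no; does; contradiction)
open import Relation.Nullary.Decidable using (dec-true; dec-false)

open ≡-Reasoning
open CommutativeSemigroupProperties +-commutativeSemigroup
  using () renaming (interchange to +-interchange)
open CommutativeSemigroupProperties (CommutativeMonoid.commutativeSemigroup ∧-commutativeMonoid)
  using () renaming (interchange to ∧-interchange)

≡ᵇ-true : ∀ {m n} → m ≡ n → (m ≡ᵇ n) ≡ true
≡ᵇ-true {m} {n} = dec-true (m ≟ n)

≡ᵇ-true⁻¹ : ∀ {m n} → (m ≡ᵇ n) ≡ true → m ≡ n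
≡ᵇ-true⁻¹ {m} {n} m≡ᵇn = ≡ᵇ⇒≡ m n (subst T (sym m≡ᵇn) _)

≡ᵇ-false : ∀ {m n} → m ≢ n → (m ≡ᵇ n) ≡ false
≡ᵇ-false {m} {n} = dec-false (m ≟ n)

≤ᵇ-true : ∀ {m n} → m ≤ n → (m ≤ᵇ n) ≡ true
≤ᵇ-true {m} {n} = dec-true (m ≤? n)

≤ᵇ-false : ∀ {m n} → ¬ m ≤ n → (m ≤ᵇ n) ≡ false
≤ᵇ-false {m} {n} = dec-false (m ≤? n)

*-if : ∀ b x y → x * (if b then y else 0) ≡ (if b then x else 0) * y
*-if true  x y = refl
*-if false x y = *-zeroʳ x

if-≤ᵇ-suc : ∀ (f : ℕ → ℕ) a N →
            (if a ≤ᵇ suc N then f a else 0)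
            ≡ (if a ≤ᵇ N then f a else 0) + (if a ≡ᵇ suc N then f (suc N) else 0)
if-≤ᵇ-suc f a N with a ≤? N | a ≟ suc N
... | yes a≤N | _
  rewrite ≤ᵇ-true (m≤n⇒m≤1+n a≤N) | ≤ᵇ-true a≤N | ≡ᵇ-false (<⇒≢ (s≤s a≤N))
  = sym (+-identityʳ (f a))
... | no a≰N | yes refl
  rewrite ≤ᵇ-true (≤-refl {suc N}) | ≤ᵇ-false a≰N | ≡ᵇ-true {suc N} refl
  = refl
... | no a≰N | no a≢1+N
  rewrite ≤ᵇ-false a≰N | ≡ᵇ-false a≢1+N | ≤ᵇ-false (λ a≤1+N → a≢1+N (≤-antisym a≤1+N (≰⇒> a≰N)))
  = refl

-- Finite sums

∑ : ℕ → (ℕ → ℕ) → ℕ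
∑ zero    f = 0
∑ (suc n) f = ∑ n f + f n

∑-cong-local : ∀ n {f g : ℕ → ℕ} → (∀ i → i < n → f i ≡ g i) → ∑ n f ≡ ∑ n g
∑-cong-local zero    f≡g = refl
∑-cong-local (suc n) f≡g =
  cong₂ _+_ (∑-cong-local n (λ i i<n → f≡g i (m<n⇒m<1+n i<n))) (f≡g n (n<1+n n))

∑-cong : ∀ n {f g : ℕ → ℕ} → f ≗ g → ∑ n f ≡ ∑ n g
∑-cong n f≗g = ∑-cong-local n (λ i _ → f≗g i)

∑≡0 : ∀ n {f : ℕ → ℕ} → (∀ i → i < n → f i ≡ 0) → ∑ n f ≡ 0
∑≡0 zero    f≡0 = refl
∑≡0 (suc n) f≡0 = cong₂ _+_ (∑≡0 n (λ i i<n → f≡0 i (m<n⇒m<1+n i<n))) (f≡0 n (n<1+n n))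

∑-first : ∀ n f → ∑ (suc n) f ≡ f 0 + ∑ n (f ∘ suc)
∑-first zero    f = +-comm 0 (f 0)
∑-first (suc n) f = begin
  ∑ (suc n) f + f (suc n)          ≡⟨ cong (_+ f (suc n)) (∑-first n f) ⟩
  f 0 + ∑ n (f ∘ suc) + f (suc n)  ≡⟨ +-assoc (f 0) _ _ ⟩
  f 0 + ∑ (suc n) (f ∘ suc)        ∎

∑-distrib-+ : ∀ n f g → ∑ n (λ i → f i + g i) ≡ ∑ n f + ∑ n g
∑-distrib-+ zero    f g = refl
∑-distrib-+ (suc n) f g = begin
  ∑ n (λ i → f i + g i) + (f n + g n) ≡⟨ cong (_+ (f n + g n)) (∑-distrib-+ n f g) ⟩
  ∑ n f + ∑ n g + (f n + g n)         ≡⟨ +-interchange (∑ n f) (∑ n g) (f n) (g n) ⟩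
  ∑ n f + f n + (∑ n g + g n)         ∎

*-distribʳ-∑ : ∀ c n f → ∑ n f * c ≡ ∑ n (λ i → f i * c)
*-distribʳ-∑ c zero    f = refl
*-distribʳ-∑ c (suc n) f =
  trans (*-distribʳ-+ c (∑ n f) (f n)) (cong (_+ f n * c) (*-distribʳ-∑ c n f))

*-distribˡ-∑ : ∀ c n f → c * ∑ n f ≡ ∑ n (λ i → c * f i)
*-distribˡ-∑ c n f = begin
  c * ∑ n f              ≡⟨ *-comm c (∑ n f) ⟩
  ∑ n f * c              ≡⟨ *-distribʳ-∑ c n f ⟩
  ∑ n (λ i → f i * c)    ≡⟨ ∑-cong n (λ i → *-comm (f i) c) ⟩
  ∑ n (λ i → c * f i)    ∎

∑-comm : ∀ m n (f : ℕ → ℕ → ℕ) → ∑ m (λ i → ∑ n (f i)) ≡ ∑ n (λ j → ∑ m (λ i → f i j))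
∑-comm zero    n f = sym (∑≡0 n (λ _ _ → refl))
∑-comm (suc m) n f = begin
  ∑ m (λ i → ∑ n (f i)) + ∑ n (f m)          ≡⟨ cong (_+ ∑ n (f m)) (∑-comm m n f) ⟩
  ∑ n (λ j → ∑ m (λ i → f i j)) + ∑ n (f m)  ≡⟨ ∑-distrib-+ n _ (f m) ⟨
  ∑ n (λ j → ∑ (suc m) (λ i → f i j))        ∎

∑-reverse : ∀ n f → ∑ n f ≡ ∑ n (λ i → f (n ∸ suc i))
∑-reverse zero    f = refl
∑-reverse (suc n) f = begin
  ∑ n f + f n                           ≡⟨ cong (_+ f n) (∑-reverse n f) ⟩
  ∑ n (λ i → f (n ∸ suc i)) + f n       ≡⟨ +-comm _ (f n) ⟩
  f n + ∑ n (λ i → f (n ∸ suc i))       ≡⟨ ∑-first n (λ i → f (suc n ∸ suc i)) ⟨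
  ∑ (suc n) (λ i → f (suc n ∸ suc i))   ∎

∑-indicator : ∀ n {q} x → q < n → ∑ n (λ i → if i ≡ᵇ q then x else 0) ≡ x
∑-indicator (suc n) {q} x q<1+n with q ≟ n
... | yes refl = cong₂ _+_
  (∑≡0 q (λ i i<q → cong (if_then x else 0) (≡ᵇ-false (<⇒≢ i<q))))
  (cong (if_then x else 0) (≡ᵇ-true {q} refl))
... | no q≢n = begin
  ∑ n (λ i → if i ≡ᵇ q then x else 0) + (if n ≡ᵇ q then x else 0)
    ≡⟨ cong₂ _+_ (∑-indicator n x (≤∧≢⇒< (≤-pred q<1+n) q≢n))
                 (cong (if_then x else 0) (≡ᵇ-false (q≢n ∘ sym))) ⟩
  x + 0 ≡⟨ +-identityʳ x ⟩
  x     ∎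

∑-prefix : ∀ n f {e} → e < n → ∑ n (λ i → if i ≤ᵇ e then f i else 0) ≡ ∑ (suc e) f
∑-prefix (suc n) f {e} e<1+n with e ≟ n
... | yes refl = cong₂ _+_
  (∑-cong-local e (λ i i<e → cong (if_then f i else 0) (≤ᵇ-true (<⇒≤ i<e))))
  (cong (if_then f e else 0) (≤ᵇ-true (≤-refl {e})))
... | no e≢n = begin
  ∑ n (λ i → if i ≤ᵇ e then f i else 0) + (if n ≤ᵇ e then f n else 0)
    ≡⟨ cong₂ _+_ (∑-prefix n f (≤∧≢⇒< (≤-pred e<1+n) e≢n))
                 (cong (if_then f n else 0)
                       (≤ᵇ-false (λ n≤e → e≢n (≤-antisym (≤-pred e<1+n) n≤e)))) ⟩
  ∑ (suc e) f + 0 ≡⟨ +-identityʳ _ ⟩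
  ∑ (suc e) f     ∎

sum-map-upTo : ∀ f n → sum (map f (upTo n)) ≡ ∑ n f
sum-map-upTo f zero    = refl
sum-map-upTo f (suc n) = begin
  sum (map f (upTo (suc n)))        ≡⟨ cong (sum ∘ map f) (upTo-∷ʳ n) ⟨
  sum (map f (upTo n ++ [ n ]))     ≡⟨ cong sum (map-++ f (upTo n) [ n ]) ⟩
  sum (map f (upTo n) ++ [ f n ])   ≡⟨ sum-++ (map f (upTo n)) [ f n ] ⟩
  sum (map f (upTo n)) + (f n + 0)  ≡⟨ cong₂ _+_ (sum-map-upTo f n) (+-identityʳ (f n)) ⟩
  ∑ n f + f n                       ∎

sum-map-range1 : ∀ f n → sum (map f (range1 n)) ≡ ∑ n (f ∘ suc)
sum-map-range1 f n = trans (cong sum (sym (map-∘ (upTo n)))) (sum-map-upTo (f ∘ suc) n)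

range1-bounded : ∀ n → All (_≤ n) (range1 n)
range1-bounded n = map⁺ (applyUpTo⁺₁ (λ i → i) n (λ i<n → i<n))

range1-suc : ∀ n → range1 (suc n) ≡ range1 n ++ [ suc n ]
range1-suc n = trans (cong (map suc) (sym (upTo-∷ʳ n))) (map-++ suc (upTo n) [ n ])

and-∷ʳ : ∀ bs b → and (bs ++ [ b ]) ≡ and bs ∧ b
and-∷ʳ []       b = ∧-identityʳ b
and-∷ʳ (c ∷ bs) b = trans (cong (c ∧_) (and-∷ʳ bs b)) (sym (∧-assoc c (and bs) b))

sum-map-concatMap : ∀ {A B : Set} (F : B → ℕ) (g : A → List B) xs →
                    sum (map F (concatMap g xs)) ≡ sum (map (λ x → sum (map F (g x))) xs)
sum-map-concatMap F g []       = refl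
sum-map-concatMap F g (x ∷ xs) = begin
  sum (map F (g x ++ concatMap g xs))
    ≡⟨ cong sum (map-++ F (g x) (concatMap g xs)) ⟩
  sum (map F (g x) ++ map F (concatMap g xs))
    ≡⟨ sum-++ (map F (g x)) _ ⟩
  sum (map F (g x)) + sum (map F (concatMap g xs))
    ≡⟨ cong (sum (map F (g x)) +_) (sum-map-concatMap F g xs) ⟩
  sum (map F (g x)) + sum (map (λ x → sum (map F (g x))) xs) ∎

length-filterᵇ : ∀ {A : Set} (p : A → Bool) xs →
                 length (filterᵇ p xs) ≡ sum (map (λ x → if p x then 1 else 0) xs)
length-filterᵇ p []       = refl
length-filterᵇ p (x ∷ xs) with p x
... | true  = cong suc (length-filterᵇ p xs)
... | false = length-filterᵇ p xs

sum-map-if : ∀ {A : Set} b (g : A → ℕ) xs →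
             sum (map (λ x → if b then g x else 0) xs) ≡ (if b then sum (map g xs) else 0)
sum-map-if true  g xs       = refl
sum-map-if false g []       = refl
sum-map-if false g (x ∷ xs) = sum-map-if false g xs

-- Binomial coefficients

-- n C⁻ k is n C (k - 1), but 0 rather than n C 0 for k = 0.
infixl 6.5 _C⁻_
_C⁻_ : ℕ → ℕ → ℕ
n C⁻ zero  = 0
n C⁻ suc k = n C k

C-pascal⁻ : ∀ n k → suc n C k ≡ n C⁻ k + n C k
C-pascal⁻ n zero    = refl
C-pascal⁻ n (suc k) = sym (nCk+nC[k+1]≡[n+1]C[k+1] n k)

[a+b]Cb≡[a+b]Ca : ∀ a b → (a + b) C b ≡ (a + b) C a
[a+b]Cb≡[a+b]Ca a b = trans (nCk≡nC[n∸k] (m≤n+m b a)) (cong ((a + b) C_) (m+n∸n≡m a b))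

[1+k]*[1+n]C[1+k]≡[1+n]*nCk : ∀ n k → suc k * (suc n C suc k) ≡ suc n * (n C k)
[1+k]*[1+n]C[1+k]≡[1+n]*nCk n       zero    =
  trans (+-identityʳ (suc n C 1)) (trans (nC1≡n (suc n)) (sym (*-identityʳ (suc n))))
[1+k]*[1+n]C[1+k]≡[1+n]*nCk zero    (suc k) = *-zeroʳ (suc (suc k))
[1+k]*[1+n]C[1+k]≡[1+n]*nCk (suc n) (suc k) = begin
  suc (suc k) * (suc (suc n) C suc (suc k))
    ≡⟨ cong (suc (suc k) *_) (nCk+nC[k+1]≡[n+1]C[k+1] (suc n) (suc k)) ⟨
  suc (suc k) * (A + B)
    ≡⟨ *-distribˡ-+ (suc (suc k)) A B ⟩
  A + suc k * A + suc (suc k) * B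
    ≡⟨ cong₂ (λ x y → A + x + y) ([1+k]*[1+n]C[1+k]≡[1+n]*nCk n k)
                                  ([1+k]*[1+n]C[1+k]≡[1+n]*nCk n (suc k)) ⟩
  A + suc n * (n C k) + suc n * (n C suc k)
    ≡⟨ +-assoc A _ _ ⟩
  A + (suc n * (n C k) + suc n * (n C suc k))
    ≡⟨ cong (A +_) (*-distribˡ-+ (suc n) (n C k) (n C suc k)) ⟨
  A + suc n * (n C k + n C suc k)
    ≡⟨ cong (λ x → A + suc n * x) (nCk+nC[k+1]≡[n+1]C[k+1] n k) ⟩
  suc (suc n) * A ∎
  where
  A = suc n C suc k
  B = suc n C suc (suc k)

[1+k]*[r+k]C[1+k]≡r*[r+k]Ck : ∀ r k → suc k * ((r + k) C suc k) ≡ r * ((r + k) C k)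
[1+k]*[r+k]C[1+k]≡r*[r+k]Ck r k = +-cancelʳ-≡ (suc k * Y) _ _ (begin
  suc k * X + suc k * Y          ≡⟨ *-distribˡ-+ (suc k) X Y ⟨
  suc k * (X + Y)                ≡⟨ cong (suc k *_) (+-comm X Y) ⟩
  suc k * (Y + X)                ≡⟨ cong (suc k *_) (nCk+nC[k+1]≡[n+1]C[k+1] (r + k) k) ⟩
  suc k * (suc (r + k) C suc k)  ≡⟨ [1+k]*[1+n]C[1+k]≡[1+n]*nCk (r + k) k ⟩
  suc (r + k) * Y                ≡⟨ cong (_* Y) (+-suc r k) ⟨
  (r + suc k) * Y                ≡⟨ *-distribʳ-+ Y r (suc k) ⟩
  r * Y + suc k * Y              ∎)
  where
  X = (r + k) C suc k
  Y = (r + k) C k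

[k[1+d]+d]C[1+d]≡k*[k[1+d]+d]Cd : ∀ k d → (k * suc d + d) C suc d ≡ k * ((k * suc d + d) C d)
[k[1+d]+d]C[1+d]≡k*[k[1+d]+d]Cd k d = *-cancelˡ-≡ _ _ (suc d) (begin
  suc d * (N C suc d)      ≡⟨ [1+k]*[r+k]C[1+k]≡r*[r+k]Ck (k * suc d) d ⟩
  k * suc d * (N C d)      ≡⟨ cong (_* (N C d)) (*-comm k (suc d)) ⟩
  suc d * k * (N C d)      ≡⟨ *-assoc (suc d) k (N C d) ⟩
  suc d * (k * (N C d))    ∎)
  where N = k * suc d + d

[1+n]*[n+m]C⁻m≡m*[n+m]Cm : ∀ n m → suc n * ((n + m) C⁻ m) ≡ m * ((n + m) C m)
[1+n]*[n+m]C⁻m≡m*[n+m]Cm n zero    = *-zeroʳ (suc n)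
[1+n]*[n+m]C⁻m≡m*[n+m]Cm n (suc d) rewrite +-suc n d =
  sym ([1+k]*[r+k]C[1+k]≡r*[r+k]Ck (suc n) d)

[1+n]*[1+n+m]Cm≡[1+n+m]*[n+m]Cm : ∀ n m →
                                  suc n * (suc (n + m) C m) ≡ suc (n + m) * ((n + m) C m)
[1+n]*[1+n+m]Cm≡[1+n+m]*[n+m]Cm n m = begin
  suc n * (suc N C m)                 ≡⟨ cong (suc n *_) (C-pascal⁻ N m) ⟩
  suc n * (N C⁻ m + N C m)            ≡⟨ *-distribˡ-+ (suc n) (N C⁻ m) (N C m) ⟩
  suc n * (N C⁻ m) + suc n * (N C m)  ≡⟨ cong (_+ suc n * (N C m)) ([1+n]*[n+m]C⁻m≡m*[n+m]Cm n m) ⟩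
  m * (N C m) + suc n * (N C m)       ≡⟨ *-distribʳ-+ (N C m) m (suc n) ⟨
  (m + suc n) * (N C m)               ≡⟨ cong (_* (N C m)) (+-comm m (suc n)) ⟩
  suc N * (N C m)                     ∎
  where N = n + m

-- Ballot numbers

module Ballot (k : ℕ) .{{_ : NonZero k}} where

  -- ballot n e counts the sequences e₁ ≤ ⋯ ≤ eₙ = e with k * eᵢ < i (eₙ read as 0 when n = 0):
  -- these are the words f(i) = i ∸ k * eᵢ that the theorem counts.
  ballot : ℕ → ℕ → ℕ
  ballot zero    e = if e ≡ᵇ 0 then 1 else 0
  ballot (suc n) e = if k * e ≤ᵇ n then ∑ (suc e) (ballot n) else 0

  ballot≤ : ℕ → ℕ → ℕ
  ballot≤ n e = ∑ (suc e) (ballot n)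

  ballot-0 : ∀ n → ballot n 0 ≡ 1
  ballot-0 zero                      = refl
  ballot-0 (suc n) rewrite *-zeroʳ k = ballot-0 n

  ballot-vanishes : ∀ n e → n < k * e → ballot n e ≡ 0
  ballot-vanishes zero    zero    0<k*0  = contradiction (subst (0 <_) (*-zeroʳ k) 0<k*0) n≮0
  ballot-vanishes zero    (suc e) _      = refl
  ballot-vanishes (suc n) e       1+n<ke =
    cong (if_then ballot≤ n e else 0) (≤ᵇ-false (λ ke≤n → <⇒≱ 1+n<ke (m≤n⇒m≤1+n ke≤n)))

  -- Pascal's rule on both sides; in the boundary column k * e = n + 1 the ballot term vanishes
  -- and absorption takes over.
  ballot≤-closed : ∀ n e → k * e ≤ n → ballot≤ n e + k * ((n + e) C⁻ e) ≡ (n + e) C e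
  ballot≤-closed n       zero    _         = cong₂ _+_ (ballot-0 n) (*-zeroʳ k)
  ballot≤-closed zero    (suc d) k[1+d]≤0  =
    contradiction (≤-trans (m≤n*m (suc d) k) k[1+d]≤0) λ ()
  ballot≤-closed (suc n) (suc d) k[1+d]≤1+n = begin
    A + B + k * (suc N C⁻ suc d)                ≡⟨ cong (λ c → A + B + k * c) (C-pascal⁻ N d) ⟩
    A + B + k * (N C⁻ d + N C d)                ≡⟨ cong (A + B +_) (*-distribˡ-+ k (N C⁻ d) (N C d)) ⟩
    A + B + (k * (N C⁻ d) + k * (N C d))        ≡⟨ +-interchange A B _ _ ⟩
    (A + k * (N C⁻ d)) + (B + k * (N C d))      ≡⟨ cong₂ _+_ earlierColumns lastColumn ⟩
    N C d + N C suc d                           ≡⟨ nCk+nC[k+1]≡[n+1]C[k+1] N d ⟩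
    suc N C suc d                               ∎
    where
    N = n + suc d
    A = ballot≤ (suc n) d
    B = ballot (suc n) (suc d)
    earlierColumns : A + k * (N C⁻ d) ≡ N C d
    earlierColumns rewrite +-suc n d =
      ballot≤-closed (suc n) d (≤-trans (*-monoʳ-≤ k (n≤1+n d)) k[1+d]≤1+n)
    lastColumn : B + k * (N C d) ≡ N C suc d
    lastColumn with k * suc d ≤? n
    ... | yes k[1+d]≤n rewrite ≤ᵇ-true k[1+d]≤n = ballot≤-closed n (suc d) k[1+d]≤n
    ... | no  k[1+d]≰n rewrite ≤ᵇ-false k[1+d]≰n =
      subst (λ M → k * (M C d) ≡ M C suc d) N≡k[1+d]+d
            (sym ([k[1+d]+d]C[1+d]≡k*[k[1+d]+d]Cd k d))
      where
      N≡k[1+d]+d : k * suc d + d ≡ N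
      N≡k[1+d]+d = trans (cong (_+ d) (≤-antisym k[1+d]≤1+n (≰⇒> k[1+d]≰n))) (sym (+-suc n d))

  ballot≤-stable : ∀ n m d → n < k * suc m → ballot≤ n (m + d) ≡ ballot≤ n m
  ballot≤-stable n m zero    _         = cong (ballot≤ n) (+-identityʳ m)
  ballot≤-stable n m (suc d) n<k[1+m] rewrite +-suc m d = begin
    ballot≤ n (m + d) + ballot n (suc (m + d))
      ≡⟨ cong (ballot≤ n (m + d) +_) (ballot-vanishes n _ n<k[1+m+d]) ⟩
    ballot≤ n (m + d) + 0 ≡⟨ +-identityʳ _ ⟩
    ballot≤ n (m + d)     ≡⟨ ballot≤-stable n m d n<k[1+m] ⟩
    ballot≤ n m           ∎
    where
    n<k[1+m+d] : n < k * suc (m + d)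
    n<k[1+m+d] = <-≤-trans n<k[1+m] (*-monoʳ-≤ k (s≤s (m≤m+n m d)))

  -- (n + 1) * (X - k * X⁻) = (n + 1 - k * m) * X by absorption, with k * m * X added on both
  -- sides so that no subtraction occurs.
  ballot≤-formula : ∀ {n m j} → j < k → n ≡ k * m + j →
                    suc n * ballot≤ n n ≡ suc j * ((n + m) C m)
  ballot≤-formula {n} {m} {j} j<k n≡km+j = +-cancelˡ-≡ (k * m * X) _ _ (begin
    k * m * X + suc n * ballot≤ n n    ≡⟨ cong (λ t → k * m * X + suc n * t) saturated ⟩
    k * m * X + suc n * P              ≡⟨ cong (_+ suc n * P) (*-assoc k m X) ⟩
    k * (m * X) + suc n * P            ≡⟨ cong (λ y → k * y + suc n * P) absorbed ⟨
    k * (suc n * X⁻) + suc n * P       ≡⟨ factor k (suc n) X⁻ P ⟩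
    suc n * (P + k * X⁻)               ≡⟨ cong (suc n *_) (ballot≤-closed n m km≤n) ⟩
    suc n * X                          ≡⟨ cong (_* X) (trans (cong suc n≡km+j) (sym (+-suc (k * m) j))) ⟩
    (k * m + suc j) * X                ≡⟨ *-distribʳ-+ X (k * m) (suc j) ⟩
    k * m * X + suc j * X              ∎)
    where
    X  = (n + m) C m
    X⁻ = (n + m) C⁻ m
    P  = ballot≤ n m
    absorbed : suc n * X⁻ ≡ m * X
    absorbed = [1+n]*[n+m]C⁻m≡m*[n+m]Cm n m
    factor : ∀ a b c t → a * (b * c) + b * t ≡ b * (t + a * c)
    factor = solve-∀
    km≤n : k * m ≤ n
    km≤n = subst (k * m ≤_) (sym n≡km+j) (m≤m+n (k * m) j)
    n<k[1+m] : n < k * suc m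
    n<k[1+m] = subst₂ _<_ (sym n≡km+j) (trans (+-comm (k * m) k) (sym (*-suc k m)))
                      (+-monoʳ-< (k * m) j<k)
    saturated : ballot≤ n n ≡ P
    saturated = trans (cong (ballot≤ n) (sym (m+[n∸m]≡n (≤-trans (m≤n*m m k) km≤n))))
                      (ballot≤-stable n m (n ∸ m) n<k[1+m])

-- Appending a letter to a word

lastFrom : ℕ → List ℕ → ℕ
lastFrom = foldl (λ _ x → x)

catalanStep : ℕ → ℕ → Bool
catalanStep c v = (1 ≤ᵇ v) ∧ (v ≤ᵇ suc c)

catalanTail-∷ʳ : ∀ p w v →
                 catalanTail p (w ++ [ v ]) ≡ catalanTail p w ∧ catalanStep (lastFrom p w) v
catalanTail-∷ʳ p []       v = cong ((1 ≤ᵇ v) ∧_) (∧-identityʳ _)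
catalanTail-∷ʳ p (x ∷ xs) v = begin
  a ∧ b ∧ catalanTail x (xs ++ [ v ])  ≡⟨ cong (λ t → a ∧ b ∧ t) (catalanTail-∷ʳ x xs v) ⟩
  a ∧ b ∧ c ∧ s                        ≡⟨ cong (a ∧_) (∧-assoc b c s) ⟨
  a ∧ (b ∧ c) ∧ s                      ≡⟨ ∧-assoc a (b ∧ c) s ⟨
  (a ∧ b ∧ c) ∧ s                      ∎
  where
  a = 1 ≤ᵇ x
  b = x ≤ᵇ suc p
  c = catalanTail x xs
  s = catalanStep (lastFrom x xs) v

-- Reading the last letter of the empty word as 0 turns the condition w₁ = 1 into a Catalan step.
isCatalan≡catalanTail0 : ∀ w → isCatalan w ≡ catalanTail 0 w
isCatalan≡catalanTail0 []                 = refl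
isCatalan≡catalanTail0 (zero ∷ ws)        = refl
isCatalan≡catalanTail0 (suc zero ∷ ws)    = refl
isCatalan≡catalanTail0 (suc (suc w) ∷ ws) = refl

isCatalan-∷ʳ : ∀ w v → isCatalan (w ++ [ v ]) ≡ isCatalan w ∧ catalanStep (lastFrom 0 w) v
isCatalan-∷ʳ w v rewrite isCatalan≡catalanTail0 (w ++ [ v ]) | isCatalan≡catalanTail0 w =
  catalanTail-∷ʳ 0 w v

transp-fixes : ∀ {a b x} → x ≢ a → x ≢ b → transp a b x ≡ x
transp-fixes x≢a x≢b rewrite ≡ᵇ-false x≢a | ≡ᵇ-false x≢b = refl

transp-matchˡ : ∀ a b → transp a b a ≡ b
transp-matchˡ a b rewrite ≡ᵇ-true {a} refl = refl

φ-from-∷ʳ : ∀ i w v x → φ-from i (w ++ [ v ]) x ≡ transp (i + length w) v (φ-from i w x)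
φ-from-∷ʳ i []       v x rewrite +-identityʳ i = refl
φ-from-∷ʳ i (w ∷ ws) v x rewrite +-suc i (length ws) = φ-from-∷ʳ (suc i) ws v (transp i w x)

Confined : ℕ → List ℕ → Set
Confined n w = length w ≡ n × (∀ x → n < x → φ w x ≡ x)

φ-∷ʳ : ∀ {n w} v x → Confined n w → φ (w ++ [ v ]) x ≡ transp (suc n) v (φ w x)
φ-∷ʳ {w = w} v x (|w|≡n , _) =
  trans (φ-from-∷ʳ 1 w v x) (cong (λ l → transp (suc l) v (φ w x)) |w|≡n)

confined-∷ʳ : ∀ {n w v} → Confined n w → v ≤ suc n → Confined (suc n) (w ++ [ v ])
confined-∷ʳ {n} {w} {v} c@(|w|≡n , fixed) v≤1+n =
  trans (length-++ w) (trans (cong (_+ 1) |w|≡n) (+-comm n 1)) , fixes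
  where
  fixes : ∀ x → suc n < x → φ (w ++ [ v ]) x ≡ x
  fixes x 1+n<x = begin
    φ (w ++ [ v ]) x          ≡⟨ φ-∷ʳ {w = w} v x c ⟩
    transp (suc n) v (φ w x)  ≡⟨ cong (transp (suc n) v) (fixed x (<-trans (n<1+n n) 1+n<x)) ⟩
    transp (suc n) v x        ≡⟨ transp-fixes (>⇒≢ 1+n<x) (>⇒≢ (≤-<-trans v≤1+n 1+n<x)) ⟩
    x                         ∎

subexcedant-confined : ∀ n → All (Confined n) (subexcedant n)
subexcedant-confined zero    = (refl , λ _ _ → refl) ∷ []
subexcedant-confined (suc n) =
  concat⁺ (map⁺ (All.map extensions-confined (subexcedant-confined n)))
  where
  extensions-confined : ∀ {w} → Confined n w →
                        All (Confined (suc n)) (map (λ v → w ++ [ v ]) (range1 (suc n)))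
  extensions-confined {w} c = map⁺ (All.map (confined-∷ʳ {w = w} c) (range1-bounded (suc n)))

-- Counting the words by their last letter

module _ (k : ℕ) .{{_ : NonZero k}} where

  open Ballot k

  transp-%-invariant : ∀ a v y → v % k ≡ a % k → transp a v y % k ≡ y % k
  transp-%-invariant a v y v≈a with y ≡ᵇ a in y≡ᵇa
  ... | true  = trans v≈a (cong (_% k) (sym (≡ᵇ-true⁻¹ y≡ᵇa)))
  ... | false with y ≡ᵇ v in y≡ᵇv
  ...   | true  = trans (sym v≈a) (cong (_% k) (sym (≡ᵇ-true⁻¹ y≡ᵇv)))
  ...   | false = refl

  isModAlt-suc : ∀ n π → isModAlt k (suc n) π ≡ isModAlt k n π ∧ (π (suc n) % k ≡ᵇ suc n % k)
  isModAlt-suc n π = begin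
    and (map test (range1 (suc n)))                ≡⟨ cong (and ∘ map test) (range1-suc n) ⟩
    and (map test (range1 n ++ [ suc n ]))         ≡⟨ cong and (map-++ test (range1 n) [ suc n ]) ⟩
    and (map test (range1 n) ++ [ test (suc n) ])  ≡⟨ and-∷ʳ (map test (range1 n)) (test (suc n)) ⟩
    and (map test (range1 n)) ∧ test (suc n)       ∎
    where
    test : ℕ → Bool
    test i = π i % k ≡ᵇ i % k

  isModAlt-cong : ∀ n {π π′ : ℕ → ℕ} → (∀ i → π i % k ≡ π′ i % k) →
                  isModAlt k n π ≡ isModAlt k n π′
  isModAlt-cong n π≈π′ = cong and (map-cong (λ i → cong (_≡ᵇ i % k) (π≈π′ i)) (range1 n))

  isModAlt-∷ʳ : ∀ {n w} v → Confined n w →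
                isModAlt k (suc n) (φ (w ++ [ v ])) ≡ isModAlt k n (φ w) ∧ (v % k ≡ᵇ suc n % k)
  isModAlt-∷ʳ {n} {w} v c@(_ , fixed) = begin
    isModAlt k (suc n) φ′                             ≡⟨ isModAlt-suc n φ′ ⟩
    isModAlt k n φ′ ∧ (φ′ (suc n) % k ≡ᵇ suc n % k)
      ≡⟨ cong (λ x → isModAlt k n φ′ ∧ (x % k ≡ᵇ suc n % k)) newValue ⟩
    isModAlt k n φ′ ∧ t                               ≡⟨ earlierValues ⟩
    isModAlt k n (φ w) ∧ t                            ∎
    where
    φ′ = φ (w ++ [ v ])
    t  = v % k ≡ᵇ suc n % k
    newValue : φ′ (suc n) ≡ v
    newValue = begin
      φ′ (suc n)                       ≡⟨ φ-∷ʳ {w = w} v (suc n) c ⟩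
      transp (suc n) v (φ w (suc n))   ≡⟨ cong (transp (suc n) v) (fixed (suc n) (n<1+n n)) ⟩
      transp (suc n) v (suc n)         ≡⟨ transp-matchˡ (suc n) v ⟩
      v                                ∎
    earlierValues : isModAlt k n φ′ ∧ t ≡ isModAlt k n (φ w) ∧ t
    earlierValues with t in t≡true
    ... | true  = cong (_∧ true) (isModAlt-cong n λ i →
      trans (cong (_% k) (φ-∷ʳ {w = w} v i c))
            (transp-%-invariant (suc n) v (φ w i) (≡ᵇ-true⁻¹ t≡true)))
    ... | false = trans (∧-zeroʳ _) (sym (∧-zeroʳ _))

  admissible : ℕ → ℕ → ℕ → Bool
  admissible n c v = catalanStep c v ∧ (v % k ≡ᵇ suc n % k)

  counted : ℕ → List ℕ → Bool
  counted n f = isCatalan f ∧ isModAlt k n (φ f)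

  counted-∷ʳ : ∀ {n w} v → Confined n w →
               counted (suc n) (w ++ [ v ]) ≡ counted n w ∧ admissible n (lastFrom 0 w) v
  counted-∷ʳ {n} {w} v c rewrite isCatalan-∷ʳ w v | isModAlt-∷ʳ {w = w} v c =
    ∧-interchange (isCatalan w) (catalanStep (lastFrom 0 w) v)
                  (isModAlt k n (φ w)) (v % k ≡ᵇ suc n % k)

  weightedCount : ℕ → (ℕ → ℕ) → ℕ
  weightedCount n h = sum (map (λ f → if counted n f then h (lastFrom 0 f) else 0) (subexcedant n))

  mpC≡weightedCount : ∀ n → mpC n k ≡ weightedCount n (λ _ → 1)
  mpC≡weightedCount n = length-filterᵇ (counted n) (subexcedant n)

  transfer : ℕ → (ℕ → ℕ) → ℕ → ℕ
  transfer n h c = ∑ (suc n) (λ i → if admissible n c (suc i) then h (suc i) else 0)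

  weightedCount-suc : ∀ n h → weightedCount (suc n) h ≡ weightedCount n (transfer n h)
  weightedCount-suc n h = begin
    sum (map F (concatMap extensions (subexcedant n)))
      ≡⟨ sum-map-concatMap F extensions (subexcedant n) ⟩
    sum (map (λ w → sum (map F (extensions w))) (subexcedant n))
      ≡⟨ cong sum (map-cong-local (All.map extensionsSum (subexcedant-confined n))) ⟩
    weightedCount n (transfer n h) ∎
    where
    F : List ℕ → ℕ
    F f = if counted (suc n) f then h (lastFrom 0 f) else 0
    letters : List ℕ
    letters = range1 (suc n)
    extensions : List ℕ → List (List ℕ)
    extensions w = map (λ v → w ++ [ v ]) letters
    extensionsSum : ∀ {w} → Confined n w →
                    sum (map F (extensions w)) ≡ (if counted n w then transfer n h (lastFrom 0 w) else 0)
    extensionsSum {w} c = begin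
      sum (map F (extensions w))                                 ≡⟨ cong sum (map-∘ letters) ⟨
      sum (map (λ v → F (w ++ [ v ])) letters)                   ≡⟨ cong sum (map-cong extended letters) ⟩
      sum (map (λ v → if counted n w then g v else 0) letters)   ≡⟨ sum-map-if (counted n w) g letters ⟩
      (if counted n w then sum (map g letters) else 0)
        ≡⟨ cong (if counted n w then_else 0) (sum-map-range1 g (suc n)) ⟩
      (if counted n w then transfer n h (lastFrom 0 w) else 0)   ∎
      where
      g : ℕ → ℕ
      g v = if admissible n (lastFrom 0 w) v then h v else 0
      extended : ∀ v → F (w ++ [ v ]) ≡ (if counted n w then g v else 0)
      extended v rewrite counted-∷ʳ {w = w} v c | foldl-∷ʳ (λ _ x → x) 0 v w = if-∧ (counted n w)

  [n∸t]%k≡ᵇn%k≡[k∣?t] : ∀ n t → t ≤ n → ((n ∸ t) % k ≡ᵇ n % k) ≡ does (k ∣? t)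
  [n∸t]%k≡ᵇn%k≡[k∣?t] n t t≤n with k ∣? t
  ... | yes (divides q t≡q*k) = ≡ᵇ-true (subst (λ s → (n ∸ s) % k ≡ n % k) (sym t≡q*k)
                                          (m*n≤o⇒[o∸m*n]%n≡o%n q (subst (_≤ n) t≡q*k t≤n)))
  ... | no k∤t = ≡ᵇ-false (λ same → k∤t (divides (n / k ∸ a / k) (t≡[n/k∸a/k]*k same)))
    where
    a = n ∸ t
    t≡[n/k∸a/k]*k : a % k ≡ n % k → t ≡ (n / k ∸ a / k) * k
    t≡[n/k∸a/k]*k a%k≡n%k = begin
      t                                          ≡⟨ m∸[m∸n]≡n t≤n ⟨
      n ∸ a                                      ≡⟨ cong₂ _∸_ (m≡m%n+[m/n]*n n k) (m≡m%n+[m/n]*n a k) ⟩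
      (n % k + n / k * k) ∸ (a % k + a / k * k)  ≡⟨ cong (λ r → _ ∸ (r + a / k * k)) a%k≡n%k ⟩
      (n % k + n / k * k) ∸ (n % k + a / k * k)  ≡⟨ [m+n]∸[m+o]≡n∸o (n % k) _ _ ⟩
      n / k * k ∸ a / k * k                      ≡⟨ *-distribʳ-∸ k (n / k) (a / k) ⟨
      (n / k ∸ a / k) * k                        ∎

  ∑-indicator-multiple : ∀ N (x : ℕ) →
                         ∑ (suc N) (λ e → if k * e ≡ᵇ N then x else 0) ≡ (if does (k ∣? N) then x else 0)
  ∑-indicator-multiple N x with k ∣? N
  ... | yes (divides q N≡q*k) =
    trans (∑-cong (suc N) (λ e → cong (if_then x else 0) (k*e≡ᵇN≡e≡ᵇq e)))
          (∑-indicator (suc N) x (s≤s q≤N))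
    where
    q≤N : q ≤ N
    q≤N = subst (q ≤_) (sym N≡q*k) (m≤m*n q k)
    k*e≡ᵇN≡e≡ᵇq : ∀ e → (k * e ≡ᵇ N) ≡ (e ≡ᵇ q)
    k*e≡ᵇN≡e≡ᵇq e with e ≟ q
    ... | yes refl = trans (≡ᵇ-true (trans (*-comm k e) (sym N≡q*k))) (sym (≡ᵇ-true {e} refl))
    ... | no e≢q   =
      trans (≡ᵇ-false (λ ke≡N → e≢q (*-cancelˡ-≡ e q k (trans ke≡N (trans N≡q*k (*-comm q k))))))
            (sym (≡ᵇ-false e≢q))
  ... | no k∤N = ∑≡0 (suc N) (λ e _ → cong (if_then x else 0)
                   (≡ᵇ-false (λ ke≡N → k∤N (divides e (trans (sym ke≡N) (*-comm k e))))))

  ∑-multiples : ∀ N (G : ℕ → ℕ) → ∑ (suc N) (λ t → if does (k ∣? t) then G t else 0)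
                      ≡ ∑ (suc N) (λ e → if k * e ≤ᵇ N then G (k * e) else 0)
  ∑-multiples zero    G rewrite *-zeroʳ k | dec-true (k ∣? 0) (k ∣0) = refl
  ∑-multiples (suc N) G = begin
    ∑ (suc N) D + D (suc N)
      ≡⟨ cong₂ _+_ (∑-multiples N G) (sym (∑-indicator-multiple (suc N) (G (suc N)))) ⟩
    ∑ (suc N) A + ∑ (suc (suc N)) B
      ≡⟨ cong (_+ ∑ (suc (suc N)) B) (trans (cong (∑ (suc N) A +_) A[1+N]≡0) (+-identityʳ _)) ⟨
    ∑ (suc (suc N)) A + ∑ (suc (suc N)) B
      ≡⟨ ∑-distrib-+ (suc (suc N)) A B ⟨
    ∑ (suc (suc N)) (λ e → A e + B e)
      ≡⟨ ∑-cong (suc (suc N)) (λ e → if-≤ᵇ-suc G (k * e) N) ⟨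
    ∑ (suc (suc N)) (λ e → if k * e ≤ᵇ suc N then G (k * e) else 0) ∎
    where
    D A B : ℕ → ℕ
    D t = if does (k ∣? t) then G t else 0
    A e = if k * e ≤ᵇ N then G (k * e) else 0
    B e = if k * e ≡ᵇ suc N then G (suc N) else 0
    A[1+N]≡0 : A (suc N) ≡ 0
    A[1+N]≡0 = cong (if_then G (k * suc N) else 0)
                    (≤ᵇ-false (λ k[1+N]≤N → 1+n≰n (≤-trans (m≤n*m (suc N) k) k[1+N]≤N)))

  catalanStep-∸ : ∀ n e e′ → k * e ≤ n → k * e′ ≤ n →
                  catalanStep (n ∸ k * e) (suc n ∸ k * e′) ≡ (e ≤ᵇ e′)
  catalanStep-∸ n e e′ ke≤n ke′≤n rewrite +-∸-assoc 1 ke′≤n with e ≤? e′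
  ... | yes e≤e′ = trans (≤ᵇ-true (s≤s (∸-monoʳ-≤ n (*-monoʳ-≤ k e≤e′)))) (sym (≤ᵇ-true e≤e′))
  ... | no  e≰e′ = trans (≤ᵇ-false (λ le → <⇒≱ (∸-monoʳ-< (*-monoʳ-< k (≰⇒> e≰e′)) ke≤n) (≤-pred le)))
                         (sym (≤ᵇ-false e≰e′))

  -- Writing the letter as v = n + 1 - t, the residue condition says k ∣ t, i.e. t = k * e′, and
  -- the Catalan step from n - k * e then says e ≤ e′.
  transfer-at : ∀ n e h → k * e ≤ n →
                transfer n h (n ∸ k * e)
                ≡ ∑ (suc n) (λ e′ → if k * e′ ≤ᵇ n then (if e ≤ᵇ e′ then h (suc n ∸ k * e′) else 0) else 0)
  transfer-at n e h ke≤n = begin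
    ∑ (suc n) (λ i → F (suc i))                                 ≡⟨ ∑-reverse (suc n) (λ i → F (suc i)) ⟩
    ∑ (suc n) (λ t → F (suc (n ∸ t)))                           ≡⟨ ∑-cong-local (suc n) byResidue ⟩
    ∑ (suc n) (λ t → if does (k ∣? t) then G t else 0)          ≡⟨ ∑-multiples n G ⟩
    ∑ (suc n) (λ e′ → if k * e′ ≤ᵇ n then G (k * e′) else 0)   ≡⟨ ∑-cong (suc n) byStep ⟩
    ∑ (suc n) (λ e′ → if k * e′ ≤ᵇ n then (if e ≤ᵇ e′ then h (suc n ∸ k * e′) else 0) else 0) ∎
    where
    c = n ∸ k * e
    F G : ℕ → ℕ
    F v = if admissible n c v then h v else 0
    G t = if catalanStep c (suc n ∸ t) then h (suc n ∸ t) else 0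
    byResidue : ∀ t → t < suc n → F (suc (n ∸ t)) ≡ (if does (k ∣? t) then G t else 0)
    byResidue t t<1+n = begin
      F (suc (n ∸ t))                      ≡⟨ cong F (+-∸-assoc 1 (≤-pred t<1+n)) ⟨
      F (suc n ∸ t)                        ≡⟨ if-∧ (catalanStep c (suc n ∸ t)) ⟩
      (if catalanStep c (suc n ∸ t) then (if residue then h (suc n ∸ t) else 0) else 0)
                                           ≡⟨ if-swap-then (catalanStep c (suc n ∸ t)) residue ⟩
      (if residue then G t else 0)
        ≡⟨ cong (if_then G t else 0) ([n∸t]%k≡ᵇn%k≡[k∣?t] (suc n) t (<⇒≤ t<1+n)) ⟩
      (if does (k ∣? t) then G t else 0)   ∎
      where residue = (suc n ∸ t) % k ≡ᵇ suc n % k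
    byStep : ∀ e′ → (if k * e′ ≤ᵇ n then G (k * e′) else 0)
                  ≡ (if k * e′ ≤ᵇ n then (if e ≤ᵇ e′ then h (suc n ∸ k * e′) else 0) else 0)
    byStep e′ with k * e′ ≤? n
    ... | yes ke′≤n rewrite ≤ᵇ-true ke′≤n | catalanStep-∸ n e e′ ke≤n ke′≤n = refl
    ... | no  ke′≰n rewrite ≤ᵇ-false ke′≰n = refl

  weightedCount≡∑ballot : ∀ n h →
                          weightedCount n h ≡ ∑ (suc n) (λ e → ballot n e * h (n ∸ k * e))
  weightedCount≡∑ballot zero    h = cong (λ z → h (0 ∸ z) + 0) (sym (*-zeroʳ k))
  weightedCount≡∑ballot (suc n) h = begin
    weightedCount (suc n) h                                    ≡⟨ weightedCount-suc n h ⟩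
    weightedCount n (transfer n h)                             ≡⟨ weightedCount≡∑ballot n (transfer n h) ⟩
    ∑ (suc n) (λ e → ballot n e * transfer n h (n ∸ k * e))    ≡⟨ ∑-cong (suc n) expand ⟩
    ∑ (suc n) (λ e → ∑ (suc n) (λ e′ → ballot n e * R e e′))   ≡⟨ ∑-comm (suc n) (suc n) _ ⟩
    ∑ (suc n) (λ e′ → ∑ (suc n) (λ e → ballot n e * R e e′))   ≡⟨ ∑-cong (suc n) collect ⟩
    ∑ (suc n) (λ e′ → ballot (suc n) e′ * H e′)                ≡⟨ +-identityʳ _ ⟨
    ∑ (suc n) (λ e′ → ballot (suc n) e′ * H e′) + 0
      ≡⟨ cong (λ b → ∑ (suc n) (λ e′ → ballot (suc n) e′ * H e′) + b * H (suc n)) lastBallot ⟨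
    ∑ (suc (suc n)) (λ e′ → ballot (suc n) e′ * H e′)          ∎
    where
    H : ℕ → ℕ
    H e′ = h (suc n ∸ k * e′)
    R : ℕ → ℕ → ℕ
    R e e′ = if k * e′ ≤ᵇ n then (if e ≤ᵇ e′ then H e′ else 0) else 0
    expand : ∀ e → ballot n e * transfer n h (n ∸ k * e) ≡ ∑ (suc n) (λ e′ → ballot n e * R e e′)
    expand e with k * e ≤? n
    ... | yes ke≤n =
      trans (cong (ballot n e *_) (transfer-at n e h ke≤n)) (*-distribˡ-∑ (ballot n e) (suc n) (R e))
    ... | no  ke≰n rewrite ballot-vanishes n e (≰⇒> ke≰n) = sym (∑≡0 (suc n) (λ _ _ → refl))
    collect : ∀ e′ → ∑ (suc n) (λ e → ballot n e * R e e′) ≡ ballot (suc n) e′ * H e′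
    collect e′ with k * e′ ≤? n
    ... | yes ke′≤n rewrite ≤ᵇ-true ke′≤n = begin
      ∑ (suc n) (λ e → ballot n e * (if e ≤ᵇ e′ then H e′ else 0))
        ≡⟨ ∑-cong (suc n) (λ e → *-if (e ≤ᵇ e′) (ballot n e) (H e′)) ⟩
      ∑ (suc n) (λ e → (if e ≤ᵇ e′ then ballot n e else 0) * H e′)
        ≡⟨ *-distribʳ-∑ (H e′) (suc n) _ ⟨
      ∑ (suc n) (λ e → if e ≤ᵇ e′ then ballot n e else 0) * H e′
        ≡⟨ cong (_* H e′) (∑-prefix (suc n) (ballot n) (s≤s (≤-trans (m≤n*m e′ k) ke′≤n))) ⟩
      ballot≤ n e′ * H e′ ∎
    ... | no  ke′≰n rewrite ≤ᵇ-false ke′≰n = ∑≡0 (suc n) (λ e _ → *-zeroʳ (ballot n e))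
    lastBallot : ballot (suc n) (suc n) ≡ 0
    lastBallot = cong (if_then ballot≤ n (suc n) else 0)
                      (≤ᵇ-false (λ k[1+n]≤n → 1+n≰n (≤-trans (m≤n*m (suc n) k) k[1+n]≤n)))

  mpC≡ballot≤ : ∀ n → mpC n k ≡ ballot≤ n n
  mpC≡ballot≤ n = begin
    mpC n k                            ≡⟨ mpC≡weightedCount n ⟩
    weightedCount n (λ _ → 1)          ≡⟨ weightedCount≡∑ballot n (λ _ → 1) ⟩
    ∑ (suc n) (λ e → ballot n e * 1)   ≡⟨ ∑-cong (suc n) (λ e → *-identityʳ (ballot n e)) ⟩
    ballot≤ n n                        ∎

  [1+n]*mpC≡[1+j]*[n+m]Cm : ∀ {n m j} → j < k → n ≡ k * m + j →
                            suc n * mpC n k ≡ suc j * ((n + m) C m)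
  [1+n]*mpC≡[1+j]*[n+m]Cm {n} j<k n≡km+j =
    trans (cong (suc n *_) (mpC≡ballot≤ n)) (ballot≤-formula j<k n≡km+j)

  [1+km]*mpC[km]≡[km+m]Cm : ∀ m → suc (k * m) * mpC (k * m) k ≡ (k * m + m) C m
  [1+km]*mpC[km]≡[km+m]Cm m =
    trans ([1+n]*mpC≡[1+j]*[n+m]Cm (>-nonZero⁻¹ k) (sym (+-identityʳ (k * m)))) (*-identityˡ _)

  [1+km+m]*mpC[km]≡[1+km+m]Cm : ∀ m → suc (k * m + m) * mpC (k * m) k ≡ suc (k * m + m) C m
  [1+km+m]*mpC[km]≡[1+km+m]Cm m = *-cancelˡ-≡ _ _ (suc a) (begin
    suc a * (suc (a + m) * X)    ≡⟨ *-assoc (suc a) (suc (a + m)) X ⟨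
    suc a * suc (a + m) * X      ≡⟨ cong (_* X) (*-comm (suc a) (suc (a + m))) ⟩
    suc (a + m) * suc a * X      ≡⟨ *-assoc (suc (a + m)) (suc a) X ⟩
    suc (a + m) * (suc a * X)    ≡⟨ cong (suc (a + m) *_) ([1+km]*mpC[km]≡[km+m]Cm m) ⟩
    suc (a + m) * ((a + m) C m)  ≡⟨ [1+n]*[1+n+m]Cm≡[1+n+m]*[n+m]Cm a m ⟨
    suc a * (suc (a + m) C m)    ∎)
    where
    a = k * m
    X = mpC a k

mainTheorem2 : (k : ℕ) .{{_ : NonZero k}} → (n m j : ℕ) → j < k → n ≡ k * m + j →
    ((k * m + j + 1) * mpC n k ≡ (j + 1) * (((k + 1) * m + j) C (k * m + j)))
  × (((k + 1) * m + 1) * mpC (k * m) k ≡ ((k + 1) * m + 1) C m)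
  × ((k * m + 1) * mpC (k * m) k ≡ ((k + 1) * m) C m)
mainTheorem2 k _ m j j<k refl = general , shiftedMultiple , multiple
  where
  n = k * m + j
  km+m≡[k+1]m : ∀ a b → a * b + b ≡ (a + 1) * b
  km+m≡[k+1]m = solve-∀
  km+j+m≡[k+1]m+j : ∀ a b c → a * b + c + b ≡ (a + 1) * b + c
  km+j+m≡[k+1]m+j = solve-∀
  general : (n + 1) * mpC n k ≡ (j + 1) * (((k + 1) * m + j) C n)
  general = begin
    (n + 1) * mpC n k                  ≡⟨ cong (_* mpC n k) (+-comm n 1) ⟩
    suc n * mpC n k                    ≡⟨ [1+n]*mpC≡[1+j]*[n+m]Cm k j<k refl ⟩
    suc j * ((n + m) C m)              ≡⟨ cong₂ _*_ (+-comm 1 j) ([a+b]Cb≡[a+b]Ca n m) ⟩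
    (j + 1) * ((n + m) C n)            ≡⟨ cong (λ N → (j + 1) * (N C n)) (km+j+m≡[k+1]m+j k m j) ⟩
    (j + 1) * (((k + 1) * m + j) C n)  ∎
  multiple : (k * m + 1) * mpC (k * m) k ≡ ((k + 1) * m) C m
  multiple = trans (cong (_* mpC (k * m) k) (+-comm (k * m) 1))
                   (trans ([1+km]*mpC[km]≡[km+m]Cm k m) (cong (_C m) (km+m≡[k+1]m k m)))
  shiftedMultiple : ((k + 1) * m + 1) * mpC (k * m) k ≡ ((k + 1) * m + 1) C m
  shiftedMultiple rewrite +-comm ((k + 1) * m) 1 | sym (km+m≡[k+1]m k m) =
    [1+km+m]*mpC[km]≡[1+km+m]Cm k m
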